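{- Let $q_1$ and $q_2$ be prime powers, each congruent to $1\pmod 3$, and let $\alpha_1,\alpha_2$ be primitive elements of $\operatorname{GF}(q_1)$ and $\operatorname{GF}(q_2)$, respectively. Suppose that $4(2q_1-q_2) = u_3(q_1)u_3(q_2)+27v_3(\alpha_1)v_3(\alpha_2)$. Then $(u_3(q_2)+u_3(q_1)/2)^2\leqslant 9q_1$ and $(v_3(\alpha_2)+v_3(\alpha_1)/2)^2\leqslant q_1/3$.
   Context: For a prime power $q = p^r \equiv 1 \pmod 3$, $u_3(q)$ is the unique integer with $u_3(q)\equiv 1\pmod 3$ such that $4q = u_3(q)^2+27v^2$ for some integer $v$, and $\gcd(u_3(q),p)=1$ when $p\equiv 1\pmod 3$; for a primitive element $\alpha$ of $\operatorname{GF}(q)$, $v_3(\alpha)$ is an integer with $4q = u_3(q)^2 + 27 v_3(\alpha)^2$ (its sign being determined by $\alpha$ via the cyclotomic number $c_3(\alpha;0,1) = (2q-4-u_3(q)-9v_3(\alpha))/18$, where $c_3(\alpha;a,b)=|\{\alpha^k+1: k\equiv a \pmod 3\}\cap\{\alpha^k: k\equiv b\pmod 3\}|$). -}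

module Defs where

open import Level using (0ℓ)
open import Data.Nat as ℕ using (ℕ; zero; suc; _∸_; _%_)
open import Data.Nat.Primality using (Prime)
open import Data.Nat.GCD using (gcd)
open import Data.Integer as ℤ using (ℤ; +_)
open import Data.Fin using (Fin)
open import Data.Fin.Properties using (_≟_)
open import Data.Bool using (Bool; true; false; if_then_else_; _∧_)
open import Data.List using (List; map; upTo; allFin)
open import Data.Bool.ListAction using (any)
open import Data.Nat.ListAction using (sum)
open import Data.Product using (Σ; ∃; _×_; _,_)
open import Relation.Binary.PropositionalEquality using (_≡_; _≢_)
open import Relation.Nullary.Decidable using (⌊_⌋)
open import Algebra.Structures using (IsCommutativeRing)
open import Algebra.Core using (Op₁; Op₂)

-- A field whose carrier is Fin q (so it has exactly q elements), with
-- propositional equality.  Any such field is a model of GF(q).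
record FiniteField (q : ℕ) : Set where
  field
    _+_ _*_ : Op₂ (Fin q)
    -_      : Op₁ (Fin q)
    0# 1#   : Fin q
    isCommutativeRing : IsCommutativeRing _≡_ _+_ _*_ -_ 0# 1#
    0≢1     : 0# ≢ 1#
    inverse : ∀ x → x ≢ 0# → ∃ λ y → x * y ≡ 1#

  infixl 7 _*_
  infixl 6 _+_

  pow : Fin q → ℕ → Fin q
  pow x zero    = 1#
  pow x (suc n) = x * pow x n

module _ {q : ℕ} (F : FiniteField q) where
  open FiniteField F

  IsPrimitive : Fin q → Set
  IsPrimitive α = pow α (q ∸ 1) ≡ 1# × (∀ k → 0 ℕ.< k → k ℕ.< q ∸ 1 → pow α k ≢ 1#)

  inC0+1 : Fin q → Fin q → Bool
  inC0+1 α x = any (λ k → ⌊ k % 3 ℕ.≟ 0 ⌋ ∧ ⌊ x ≟ pow α k + 1# ⌋) (upTo (q ∸ 1))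

  inC1 : Fin q → Fin q → Bool
  inC1 α x = any (λ k → ⌊ k % 3 ℕ.≟ 1 ⌋ ∧ ⌊ x ≟ pow α k ⌋) (upTo (q ∸ 1))

  c3-01 : Fin q → ℕ
  c3-01 α = sum (map (λ x → if inC0+1 α x ∧ inC1 α x then 1 else 0) (allFin q))

IsPrimePowerOf : ℕ → ℕ → Set
IsPrimePowerOf p q = Prime p × Σ ℕ λ r → 1 ℕ.≤ r × q ≡ p ℕ.^ r

-- u = u_3(q), where q is a power of the prime p (u_3 is unique with these properties)
IsU3 : ℕ → ℕ → ℤ → Set
IsU3 p q u =
  (∃ λ k → u ≡ + 1 ℤ.+ + 3 ℤ.* k) ×
  (∃ λ v → + 4 ℤ.* + q ≡ u ℤ.* u ℤ.+ + 27 ℤ.* (v ℤ.* v)) ×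
  (p % 3 ≡ 1 → gcd ℤ.∣ u ∣ p ≡ 1)

IsV3 : {q : ℕ} → FiniteField q → ℤ → Fin q → ℤ → Set
IsV3 {q} F u α v =
  (+ 4 ℤ.* + q ≡ u ℤ.* u ℤ.+ + 27 ℤ.* (v ℤ.* v)) ×
  (+ 18 ℤ.* + c3-01 F α ≡ + 2 ℤ.* + q ℤ.- + 4 ℤ.- u ℤ.- + 9 ℤ.* v)

{-# OPTIONS --safe #-}
module Submission where

open import Defs
open import Data.Nat as ℕ using (ℕ; _%_)
open import Data.Integer as ℤ using (ℤ; +_; 0ℤ; NonNegative; _+_; _-_; _*_; _≤_)
open import Data.Integer.Properties
  using (≤-refl; i≤i+j; i≤j+i; *-monoˡ-≤-nonNeg; *-zeroʳ; *-assoc; *-cancelˡ-≤-pos)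
open import Data.Integer.Tactic.RingSolver using (solve-∀; solve)
open import Data.List using (_∷_; [])
open import Data.Fin using (Fin)
open import Data.Product using (_×_; _,_)
open import Relation.Binary.PropositionalEquality
  using (_≡_; sym; cong₂; subst; subst₂; module ≡-Reasoning)

-- With Q(x, y) = x² + 27y² and P its polar form,
--   Q(2u₂ + u₁, 2v₂ + v₁) = Q(u₁, v₁) + 4 P(u₁, v₁; u₂, v₂) + 4 Q(u₂, v₂)
--                         = 4q₁ + 16(2q₁ − q₂) + 16q₂ = 36q₁,
-- and each of the two non-negative summands of Q is at most 36q₁.

quadForm : ℤ → ℤ → ℤ → ℤ
quadForm d x y = x * x + d * (y * y)

polarForm : ℤ → ℤ → ℤ → ℤ → ℤ → ℤ
polarForm d x y x′ y′ = x * x′ + d * (y * y′)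

0≤i*i : ∀ i → 0ℤ ≤ i * i
0≤i*i (+ 0)      = ≤-refl
0≤i*i ℤ.+[1+ n ] = ℤ.+≤+ ℕ.z≤n
0≤i*i ℤ.-[1+ n ] = ℤ.+≤+ ℕ.z≤n

square≤quadForm : ∀ d .{{_ : NonNegative d}} x y → x * x ≤ quadForm d x y
square≤quadForm d x y = i≤i+j (x * x) (d * (y * y)) {{ℤ.nonNegative 0≤d*y*y}}
  where
  0≤d*y*y : 0ℤ ≤ d * (y * y)
  0≤d*y*y = subst (_≤ d * (y * y)) (*-zeroʳ d) (*-monoˡ-≤-nonNeg d (0≤i*i y))

scaledSquare≤quadForm : ∀ d x y → d * (y * y) ≤ quadForm d x y
scaledSquare≤quadForm d x y = i≤j+i (d * (y * y)) (x * x) {{ℤ.nonNegative (0≤i*i x)}}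

quadForm-2x+x′ : ∀ d x y x′ y′ →
  quadForm d (+ 2 * x + x′) (+ 2 * y + y′)
    ≡ quadForm d x′ y′ + + 4 * polarForm d x′ y′ x y + + 4 * quadForm d x y
quadForm-2x+x′ d x y x′ y′ = expand d x y x′ y′
  where
  -- solve-∀ does not unfold quadForm and polarForm, so the goal is restated unfolded.
  expand : ∀ d x y x′ y′ →
    (+ 2 * x + x′) * (+ 2 * x + x′) + d * ((+ 2 * y + y′) * (+ 2 * y + y′))
      ≡ x′ * x′ + d * (y′ * y′) + + 4 * (x′ * x + d * (y′ * y)) + + 4 * (x * x + d * (y * y))
  expand = solve-∀

quadForm-36 : ∀ d x y x′ y′ m n →
  + 4 * m ≡ quadForm d x′ y′ → + 4 * n ≡ quadForm d x y →
  + 4 * (+ 2 * m - n) ≡ polarForm d x′ y′ x y →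
  quadForm d (+ 2 * x + x′) (+ 2 * y + y′) ≡ + 36 * m
quadForm-36 d x y x′ y′ m n 4m≡Q′ 4n≡Q 4[2m-n]≡P = begin
  quadForm d (+ 2 * x + x′) (+ 2 * y + y′)
    ≡⟨ quadForm-2x+x′ d x y x′ y′ ⟩
  quadForm d x′ y′ + + 4 * polarForm d x′ y′ x y + + 4 * quadForm d x y
    ≡⟨ sym (cong₂ (λ a b → a + + 4 * b) (cong₂ (λ a b → a + + 4 * b) 4m≡Q′ 4[2m-n]≡P) 4n≡Q) ⟩
  + 4 * m + + 4 * (+ 4 * (+ 2 * m - n)) + + 4 * (+ 4 * n)
    ≡⟨ solve (m ∷ n ∷ []) ⟩
  + 36 * m ∎
  where open ≡-Reasoning

lemma4p6 : (p₁ q₁ p₂ q₂ : ℕ) → IsPrimePowerOf p₁ q₁ → IsPrimePowerOf p₂ q₂ →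
    q₁ % 3 ≡ 1 → q₂ % 3 ≡ 1 →
    (F₁ : FiniteField q₁) (F₂ : FiniteField q₂) (α₁ : Fin q₁) (α₂ : Fin q₂) →
    IsPrimitive F₁ α₁ → IsPrimitive F₂ α₂ →
    (u₁ u₂ v₁ v₂ : ℤ) → IsU3 p₁ q₁ u₁ → IsU3 p₂ q₂ u₂ →
    IsV3 F₁ u₁ α₁ v₁ → IsV3 F₂ u₂ α₂ v₂ →
    + 4 ℤ.* (+ 2 ℤ.* + q₁ ℤ.- + q₂) ≡ u₁ ℤ.* u₂ ℤ.+ + 27 ℤ.* (v₁ ℤ.* v₂) →
    ((+ 2 ℤ.* u₂ ℤ.+ u₁) ℤ.* (+ 2 ℤ.* u₂ ℤ.+ u₁) ℤ.≤ + 36 ℤ.* + q₁)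
      × (+ 3 ℤ.* ((+ 2 ℤ.* v₂ ℤ.+ v₁) ℤ.* (+ 2 ℤ.* v₂ ℤ.+ v₁)) ℤ.≤ + 4 ℤ.* + q₁)
lemma4p6 _ q₁ _ q₂ _ _ _ _ _ _ _ _ _ _ u₁ u₂ v₁ v₂ _ _ (4q₁≡Q₁ , _) (4q₂≡Q₂ , _) 4[2q₁-q₂]≡P =
  subst (a * a ≤_) Q≡36q₁ (square≤quadForm (+ 27) a b) ,
  *-cancelˡ-≤-pos _ _ (+ 9) 9·3b²≤9·4q₁
  where
  a b : ℤ
  a = + 2 * u₂ + u₁
  b = + 2 * v₂ + v₁

  Q≡36q₁ : quadForm (+ 27) a b ≡ + 36 * + q₁
  Q≡36q₁ = quadForm-36 (+ 27) u₂ v₂ u₁ v₁ (+ q₁) (+ q₂) 4q₁≡Q₁ 4q₂≡Q₂ 4[2q₁-q₂]≡P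

  -- + 9 * + 3 and + 9 * + 4 compute to + 27 and + 36.
  9·3b²≤9·4q₁ : + 9 * (+ 3 * (b * b)) ≤ + 9 * (+ 4 * + q₁)
  9·3b²≤9·4q₁ = subst₂ _≤_ (*-assoc (+ 9) (+ 3) (b * b)) (*-assoc (+ 9) (+ 4) (+ q₁))
    (subst (+ 27 * (b * b) ≤_) Q≡36q₁ (scaledSquare≤quadForm (+ 27) a b))
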